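{- For every positive integer $n$, during a complete run of $\mathrm{RuleAsc}(n)$, the two statements "$y\leftarrow a_k-1$" and "$x\leftarrow a_k+1$" (the read operations of the algorithm) are executed a total of exactly $2p(n)$ times.
   Context: $p(n)$ denotes the number of partitions of $n$. The procedure $\mathrm{RuleAsc}(n)$, for $n>0$, operates on an array $a$ as follows and visits every ascending composition of $n$ (a sequence of positive integers in nondecreasing order summing to $n$) exactly once, in lexicographic order: 1. $k\leftarrow 2$; $a_1\leftarrow 0$; $a_2\leftarrow n$. 2. While $k\ne 1$: - $y\leftarrow a_k-1$; $k\leftarrow k-1$; $x\leftarrow a_k+1$. - While $x\le y$: $a_k\leftarrow x$; $y\leftarrow y-x$; $k\leftarrow k+1$. - $a_k\leftarrow x+y$; visit $\langle a_1,\dots,a_k\rangle$. -}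

module Defs where

open import Data.Nat using (ℕ; zero; suc; _+_; _∸_; _<_; _≥_; _≟_; _≤?_; _≡ᵇ_)
open import Data.Nat.Properties
open import Data.Bool using (if_then_else_)
open import Data.List using (List)
open import Data.Nat.ListAction using (sum)
open import Data.List.Relation.Unary.All using (All)
open import Data.List.Relation.Unary.Linked using (Linked)
open import Data.Maybe using (Maybe; just; nothing)
open import Data.Product using (Σ; _×_)
open import Relation.Binary.PropositionalEquality using (_≡_)
open import Relation.Nullary using (yes; no)

Partition : ℕ → Set
Partition n = Σ (List ℕ) (λ l → All (λ x → 0 < x) l × Linked _≥_ l × sum l ≡ n)

-- The array a, indexed by positions 1,2,3,...  (position 0 unused).
Array : Set
Array = ℕ → ℕ

update : Array → ℕ → ℕ → Array
update a i v j = if j ≡ᵇ i then v else a j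

-- The last argument c counts how many
-- times the read statements "y ← a_k - 1" and "x ← a_k + 1" have been executed.
-- The "visit" statement has no effect on the state and is omitted.
mutual
  outerLoop : ℕ → (k : ℕ) → Array → (c : ℕ) → Maybe ℕ
  outerLoop zero k a c = nothing
  outerLoop (suc f) k a c with k ≟ 1
  ... | yes _ = just c
  ... | no _ =
    let y  = a k ∸ 1
        c₁ = suc c
        k₁ = k ∸ 1
        x  = a k₁ + 1
        c₂ = suc c₁
    in innerLoop f k₁ x y a c₂

  innerLoop : ℕ → (k x y : ℕ) → Array → (c : ℕ) → Maybe ℕ
  innerLoop zero k x y a c = nothing
  innerLoop (suc f) k x y a c with x ≤? y
  ... | yes _ = innerLoop f (suc k) x (y ∸ x) (update a k x) c
  ... | no _  = outerLoop f k (update a k (x + y)) c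

-- Initialisation: k ← 2; a_1 ← 0; a_2 ← n  (other cells are never read before written).
initArray : ℕ → Array
initArray n = update (update (λ _ → 0) 1 0) 2 n

runRuleAsc : ℕ → ℕ → Maybe ℕ
runRuleAsc fuel n = outerLoop fuel 2 (initArray n) 0

-- Call lb, lb, …, lb, r with lb ≤ r < 2 lb "the first ascending composition of
-- s with parts ≥ lb" (`FirstAsc`); it is exactly what the inner loop writes
-- (`fill`).  The heart of the proof is a simulation lemma (`Sweeps`): an outer
-- loop run started with that first composition at positions j+1..k returns to
-- k = j+1 with a(j+1) = s, leaves a(1..j) untouched, and performs 2h reads.
-- `enumerate` shows that h + 1 is the number of ascending compositions of s
-- with parts ≥ lb, by one recursion on both sides: if s < 2 lb then [s] is the
-- only composition (`asc-single`, `sweep-single`); otherwise s = lb + s₁ and a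
-- composition either starts with lb or has all parts ≥ lb + 1 (`asc-split`),
-- while the algorithm sweeps the compositions of s₁ at j+2.., makes one outer
-- pass (two reads) whose inner loop writes the first composition of s with parts
-- ≥ lb + 1 at j+1.., and sweeps that (`sweep-split`).  Finally partitions are, by
-- reversal, ascending compositions (`partition↔asc`), so the initial pass plus
-- the sweep for lb = 1 costs 2 + 2h = 2 p(n) reads.
module Submission where

open import Defs
open import Data.Nat using (ℕ; zero; suc; _+_; _*_; _∸_; _≤_; _<_; _≟_; _<?_; _≤?_; _≡ᵇ_; z≤n; s≤s; s≤s⁻¹)
open import Data.Nat.Properties
open import Data.Nat.ListAction using (sum)
open import Data.Nat.ListAction.Properties using (sum-↭)
open import Data.Nat.Tactic.RingSolver using (solve-∀)
open import Data.Bool using (true; false; T)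
open import Data.Unit using (tt)
open import Data.Maybe using (just)
open import Data.Product using (Σ; ∃; _×_; _,_; proj₁)
open import Data.Sum using (_⊎_; inj₁; inj₂)
open import Data.List using (List; []; _∷_; reverse; reverseAcc)
open import Data.List.Properties using (reverse-involutive)
open import Data.List.Relation.Unary.All as All using (All; []; _∷_)
open import Data.List.Relation.Unary.Linked as Linked using (Linked; []; [-]; _∷_)
open import Data.List.Relation.Unary.Linked.Properties using (Linked⇒All)
open import Data.List.Relation.Binary.Permutation.Propositional using (↭-sym)
open import Data.List.Relation.Binary.Permutation.Propositional.Properties
  using (↭-reverse; All-resp-↭)
open import Data.Fin using (Fin)
open import Data.Fin.Properties using (+↔⊎)
open import Data.Fin.Permutation using (↔⇒≡)
open import Data.Sum.Function.Propositional using (_⊎-↔_)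
open import Function.Base using (flip)
open import Function.Bundles using (_↔_; mk↔ₛ′)
open import Function.Properties.Inverse using (↔-trans; ↔-sym)
open import Relation.Binary.PropositionalEquality
  using (_≡_; _≢_; refl; sym; trans; cong; cong₂; subst; module ≡-Reasoning)
open import Relation.Nullary using (¬_; yes; no; contradiction)

open ≡-Reasoning

update-same : ∀ a k v → update a k v k ≡ v
update-same a k v with k ≡ᵇ k in eq
... | true  = refl
... | false = contradiction (subst T eq (≡⇒≡ᵇ k k refl)) λ ()

update-other : ∀ a k v {i} → i ≢ k → update a k v i ≡ a i
update-other a k v {i} i≢k with i ≡ᵇ k in eq
... | true  = contradiction (≡ᵇ⇒≡ i k (subst T (sym eq) tt)) i≢k
... | false = refl

SameBelow : ℕ → Array → Array → Set
SameBelow j a a' = ∀ i → i < j → a' i ≡ a i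

-- Positions j..k of a hold the first ascending composition of s with parts ≥ lb,
-- i.e. lb, …, lb, r with lb ≤ r < 2 lb (the bound r ≥ lb is carried by `cons`).
data FirstAsc (a : Array) (lb : ℕ) : (j s k : ℕ) → Set where
  single : ∀ {j s} → s < lb + lb → a j ≡ s → FirstAsc a lb j s j
  cons   : ∀ {j s s₁ k} → s ≡ lb + s₁ → lb ≤ s₁ → a j ≡ lb →
           FirstAsc a lb (suc j) s₁ k → FirstAsc a lb j s k

inner-continue : ∀ f k x y a c → x ≤ y →
  innerLoop (suc f) k x y a c ≡ innerLoop f (suc k) x (y ∸ x) (update a k x) c
inner-continue f k x y a c x≤y with x ≤? y
... | yes _   = refl
... | no x≰y = contradiction x≤y x≰y

inner-exit : ∀ f k x y a c → ¬ (x ≤ y) →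
  innerLoop (suc f) k x y a c ≡ outerLoop f k (update a k (x + y)) c
inner-exit f k x y a c x≰y with x ≤? y
... | yes x≤y = contradiction x≤y x≰y
... | no _    = refl

outer-pass : ∀ f j a c → outerLoop (suc f) (suc (suc j)) a c ≡
  innerLoop f (suc j) (a (suc j) + 1) (a (suc (suc j)) ∸ 1) a (2 + c)
outer-pass f j a c = refl

Fills : ℕ → ℕ → Set
Fills x y = Σ ℕ λ fuel → ∀ k a c F → Σ Array λ a' → Σ ℕ λ k' →
  SameBelow k a a' × FirstAsc a' x k (x + y) k' ×
  innerLoop (fuel + F) k x y a c ≡ outerLoop F k' a' c

-- Induction on a bound u > y; each iteration decreases y by x ≥ 1.
fill-below : ∀ u x y → y < u → 1 ≤ x → Fills x y
fill-below (suc u) x y y<u+1 1≤x with x ≤? y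
... | no x≰y = 1 , λ k a c F →
  update a k (x + y) , k , (λ i i<k → update-other a k _ (<⇒≢ i<k)) ,
  single (+-monoʳ-< x (≰⇒> x≰y)) (update-same a k (x + y)) , inner-exit F k x y a c x≰y
... | yes x≤y
  with fuel , rest ← fill-below u x (y ∸ x) (<-≤-trans (∸-monoʳ-< {y} 1≤x x≤y) (s≤s⁻¹ y<u+1)) 1≤x
  = suc fuel , λ k a c F →
  let (a' , k' , same , first , run) = rest (suc k) (update a k x) c F in
  a' , k' ,
  (λ i i<k → trans (same i (m<n⇒m<1+n i<k)) (update-other a k x (<⇒≢ i<k))) ,
  cons (cong (x +_) (sym (m+[n∸m]≡n x≤y))) (m≤m+n x (y ∸ x))
       (trans (same k (n<1+n k)) (update-same a k x)) first ,
  trans (inner-continue (fuel + F) k x y a c x≤y) run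

fill : ∀ x y → 1 ≤ x → Fills x y
fill x y = fill-below (suc y) x y ≤-refl

Sweeps : ℕ → ℕ → ℕ → Set
Sweeps lb s h = Σ ℕ λ fuel → ∀ j a k c F → FirstAsc a lb (suc j) s k →
  Σ Array λ a' → SameBelow (suc j) a a' × a' (suc j) ≡ s ×
  outerLoop (fuel + F) k a c ≡ outerLoop F (suc j) a' (h + h + c)

-- If s < 2 lb the first composition is [s]: there is nothing to do.
sweep-single : ∀ {lb s} → s < lb + lb → Sweeps lb s 0
sweep-single {lb} {s} s<2lb = 0 , body
  where
  body : ∀ j a k c F → FirstAsc a lb (suc j) s k →
    Σ Array λ a' → SameBelow (suc j) a a' × a' (suc j) ≡ s ×
    outerLoop (0 + F) k a c ≡ outerLoop F (suc j) a' (0 + 0 + c)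
  body j a .(suc j) c F (single _ a≡s) = a , (λ _ _ → refl) , a≡s , refl
  body j a k c F (cons s≡lb+s₁ lb≤s₁ _ _) =
    contradiction (subst (lb + lb ≤_) (sym s≡lb+s₁) (+-monoʳ-≤ lb lb≤s₁)) (<⇒≱ s<2lb)

split-fuel : ∀ f₁ f₂ f₃ F → f₁ + suc (f₂ + f₃) + F ≡ f₁ + suc (f₂ + (f₃ + F))
split-fuel = solve-∀

split-reads : ∀ h₁ h₂ c → h₂ + h₂ + (2 + (h₁ + h₁ + c)) ≡ h₁ + suc h₂ + (h₁ + suc h₂) + c
split-reads = solve-∀

-- For s = lb + s₁ with s₁ ≥ lb: sweep the compositions of s₁ at positions j+2..,
-- make one outer pass (two reads), which lets the inner loop write the first
-- composition of s with parts ≥ lb + 1 at j+1.., and sweep that one.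
sweep-split : ∀ {lb s₁ h₁ h₂} → 1 ≤ lb → lb ≤ s₁ →
  Sweeps lb s₁ h₁ → Sweeps (suc lb) (lb + s₁) h₂ → Sweeps lb (lb + s₁) (h₁ + suc h₂)
sweep-split {lb} {zero} 1≤lb lb≤0 _ _ = contradiction (≤-trans 1≤lb lb≤0) λ ()
sweep-split {lb} {suc s₂} {h₁} {h₂} _ lb≤s₁ (fuel₁ , sweep₁) (fuel₂ , sweep₂)
  with fuelF , fill-s ← fill (suc lb) s₂ (s≤s z≤n) = fuel₁ + suc (fuelF + fuel₂) , body
  where
  s = lb + suc s₂

  body : ∀ j a k c F → FirstAsc a lb (suc j) s k →
    Σ Array λ a' → SameBelow (suc j) a a' × a' (suc j) ≡ s ×
    outerLoop (fuel₁ + suc (fuelF + fuel₂) + F) k a c ≡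
    outerLoop F (suc j) a' (h₁ + suc h₂ + (h₁ + suc h₂) + c)
  body j a k c F (single s<2lb _) =
    contradiction (+-monoʳ-≤ lb lb≤s₁) (<⇒≱ s<2lb)
  body j a k c F (cons s≡lb+s₁ _ a≡lb first)
    with refl ← +-cancelˡ-≡ lb _ _ s≡lb+s₁
    with a₁ , same₁ , top₁ , run₁ ← sweep₁ (suc j) a k c (suc (fuelF + (fuel₂ + F))) first
    with a₂ , k₂ , same₂ , first₂ , run₂ ← fill-s (suc j) a₁ (2 + (h₁ + h₁ + c)) (fuel₂ + F)
    with a₃ , same₃ , top₃ , run₃ ← sweep₂ j a₂ k₂ (2 + (h₁ + h₁ + c)) F
                                      (subst (λ t → FirstAsc a₂ (suc lb) (suc j) t k₂)
                                             (sym (+-suc lb s₂)) first₂)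
    = a₃ ,
      (λ i i<j+1 → trans (same₃ i i<j+1) (trans (same₂ i i<j+1) (same₁ i (m<n⇒m<1+n i<j+1)))) ,
      top₃ ,
      (begin
      outerLoop (fuel₁ + suc (fuelF + fuel₂) + F) k a c
        ≡⟨ cong (λ f → outerLoop f k a c) (split-fuel fuel₁ fuelF fuel₂ F) ⟩
      outerLoop (fuel₁ + suc (fuelF + (fuel₂ + F))) k a c
        ≡⟨ run₁ ⟩
      outerLoop (suc (fuelF + (fuel₂ + F))) (suc (suc j)) a₁ (h₁ + h₁ + c)
        ≡⟨ outer-pass (fuelF + (fuel₂ + F)) j a₁ (h₁ + h₁ + c) ⟩
      innerLoop (fuelF + (fuel₂ + F)) (suc j) (a₁ (suc j) + 1) (a₁ (suc (suc j)) ∸ 1) a₁ (2 + (h₁ + h₁ + c))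
        ≡⟨ cong₂ (λ x y → innerLoop (fuelF + (fuel₂ + F)) (suc j) x y a₁ (2 + (h₁ + h₁ + c))) read-x read-y ⟩
      innerLoop (fuelF + (fuel₂ + F)) (suc j) (suc lb) s₂ a₁ (2 + (h₁ + h₁ + c))
        ≡⟨ run₂ ⟩
      outerLoop (fuel₂ + F) k₂ a₂ (2 + (h₁ + h₁ + c))
        ≡⟨ run₃ ⟩
      outerLoop F (suc j) a₃ (h₂ + h₂ + (2 + (h₁ + h₁ + c)))
        ≡⟨ cong (outerLoop F (suc j) a₃) (split-reads h₁ h₂ c) ⟩
      outerLoop F (suc j) a₃ (h₁ + suc h₂ + (h₁ + suc h₂) + c) ∎)
    where
    read-x : a₁ (suc j) + 1 ≡ suc lb
    read-x = trans (cong (_+ 1) (trans (same₁ (suc j) (n<1+n (suc j))) a≡lb)) (+-comm lb 1)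
    read-y : a₁ (suc (suc j)) ∸ 1 ≡ s₂
    read-y = cong (_∸ 1) top₁

-- Ascending compositions of s with all parts ≥ lb: lb is prepended to the chain.
Asc : ℕ → ℕ → Set
Asc lb s = Σ (List ℕ) λ l → Linked _≤_ (lb ∷ l) × sum l ≡ s

Asc-≡ : ∀ {lb s} {p q : Asc lb s} → proj₁ p ≡ proj₁ q → p ≡ q
Asc-≡ {p = l , asc , sum≡} {.l , asc' , sum≡'} refl =
  cong (l ,_) (cong₂ _,_ (Linked.irrelevant ≤-irrelevant asc asc') (≡-irrelevant sum≡ sum≡'))

asc-single : ∀ {lb s} → 1 ≤ lb → lb ≤ s → s < lb + lb → Fin 1 ↔ Asc lb s
asc-single {lb} {s} 1≤lb lb≤s s<2lb =
  mk↔ₛ′ (λ _ → singleton) (λ _ → Fin.zero) (λ p → Asc-≡ (sym (only p))) λ { Fin.zero → refl ; (Fin.suc ()) }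
  where
  singleton : Asc lb s
  singleton = s ∷ [] , lb≤s ∷ [-] , +-identityʳ s
  only : ∀ (p : Asc lb s) → proj₁ p ≡ s ∷ []
  only ([] , _ , 0≡s) = contradiction (≤-trans 1≤lb lb≤s) (subst (λ t → ¬ 1 ≤ t) 0≡s λ ())
  only (x ∷ [] , _ , x+0≡s) = cong (_∷ []) (trans (sym (+-identityʳ x)) x+0≡s)
  only (x ∷ y ∷ l , lb≤x ∷ x≤y ∷ _ , sum≡s) = contradiction two-parts (<⇒≱ s<2lb)
    where
    two-parts : lb + lb ≤ s
    two-parts = subst (lb + lb ≤_) sum≡s
      (+-mono-≤ lb≤x (≤-trans (≤-trans lb≤x x≤y) (m≤m+n y (sum l))))

asc-split : ∀ {lb s₁} → 1 ≤ lb → Asc lb (lb + s₁) ↔ (Asc lb s₁ ⊎ Asc (suc lb) (lb + s₁))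
asc-split {lb} {s₁} 1≤lb = mk↔ₛ′ to from to∘from from∘to
  where
  nonempty : ∀ {A : Set} → 0 ≡ lb + s₁ → A
  nonempty 0≡s = contradiction (≤-trans 1≤lb (m≤m+n lb s₁)) (subst (λ t → ¬ 1 ≤ t) 0≡s λ ())

  to : Asc lb (lb + s₁) → Asc lb s₁ ⊎ Asc (suc lb) (lb + s₁)
  to ([] , _ , 0≡s) = nonempty 0≡s
  to (x ∷ l , lb≤x ∷ asc , sum≡) with x ≟ lb
  ... | yes refl = inj₁ (l , asc , +-cancelˡ-≡ x _ _ sum≡)
  ... | no x≢lb  = inj₂ (x ∷ l , ≤∧≢⇒< lb≤x (λ lb≡x → x≢lb (sym lb≡x)) ∷ asc , sum≡)

  from : Asc lb s₁ ⊎ Asc (suc lb) (lb + s₁) → Asc lb (lb + s₁)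
  from (inj₁ (l , asc , sum≡)) = lb ∷ l , ≤-refl ∷ asc , cong (lb +_) sum≡
  from (inj₂ (l , asc , sum≡)) = l , weaken asc , sum≡
    where
    weaken : ∀ {l} → Linked _≤_ (suc lb ∷ l) → Linked _≤_ (lb ∷ l)
    weaken [-] = [-]
    weaken (lb<x ∷ asc) = <⇒≤ lb<x ∷ asc

  from∘to : ∀ p → from (to p) ≡ p
  from∘to ([] , _ , 0≡s) = nonempty 0≡s
  from∘to (x ∷ l , lb≤x ∷ asc , sum≡) with x ≟ lb
  ... | yes refl = Asc-≡ refl
  ... | no _     = Asc-≡ refl

  to∘from : ∀ q → to (from q) ≡ q
  to∘from (inj₁ (l , asc , sum≡)) with lb ≟ lb
  ... | yes refl  = cong inj₁ (Asc-≡ refl)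
  ... | no lb≢lb = contradiction refl lb≢lb
  to∘from (inj₂ ([] , _ , 0≡s)) = nonempty 0≡s
  to∘from (inj₂ (x ∷ l , lb<x ∷ asc , sum≡)) with x ≟ lb
  ... | yes refl = contradiction lb<x (n≮n x)
  ... | no _     = cong inj₂ (Asc-≡ refl)

split-first-part : ∀ {lb s} → lb + lb ≤ s → ∃ λ s₁ → lb ≤ s₁ × s ≡ lb + s₁
split-first-part {lb} lb+lb≤s with m≤n⇒∃[o]m+o≡n (≤-trans (m≤m+n lb lb) lb+lb≤s)
... | s₁ , refl = s₁ , +-cancelˡ-≤ lb lb s₁ lb+lb≤s , refl

-- The simulation lemma: the number of compositions is h + 1 and the sweep costs
-- 2h reads.  Induction on t with s < t + lb (the measure s ∸ lb decreases).
enumerate : ∀ t {lb s} → s < t + lb → 1 ≤ lb → lb ≤ s →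
  Σ ℕ λ h → (Fin (suc h) ↔ Asc lb s) × Sweeps lb s h
enumerate zero s<lb _ lb≤s = contradiction lb≤s (<⇒≱ s<lb)
enumerate (suc t) {lb} {s} s<t+1+lb 1≤lb lb≤s with s <? lb + lb
... | yes s<2lb = 0 , asc-single 1≤lb lb≤s s<2lb , sweep-single s<2lb
... | no s≮2lb with split-first-part {lb} (≮⇒≥ s≮2lb)
...   | s₁ , lb≤s₁ , refl
  with h₁ , count₁ , sweep₁ ← enumerate t (<-≤-trans (m<n+m s₁ 1≤lb) (s≤s⁻¹ s<t+1+lb)) 1≤lb lb≤s₁
  with h₂ , count₂ , sweep₂ ← enumerate t (subst (lb + s₁ <_) (sym (+-suc t lb)) s<t+1+lb)
                                (s≤s z≤n) (m<m+n lb (≤-trans 1≤lb lb≤s₁))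
  = h₁ + suc h₂ ,
    ↔-trans +↔⊎ (↔-trans (count₁ ⊎-↔ count₂) (↔-sym (asc-split 1≤lb))) ,
    sweep-split {h₁ = h₁} {h₂ = h₂} 1≤lb lb≤s₁ sweep₁ sweep₂

linked-reverseAcc : ∀ {R : ℕ → ℕ → Set} x l acc →
  Linked R (x ∷ l) → Linked (flip R) (x ∷ acc) → Linked (flip R) (reverseAcc acc (x ∷ l))
linked-reverseAcc x [] acc _ rev = rev
linked-reverseAcc x (y ∷ l) acc (Rxy ∷ linked) rev = linked-reverseAcc y l (x ∷ acc) linked (Rxy ∷ rev)

linked-reverse : ∀ {R : ℕ → ℕ → Set} l → Linked R l → Linked (flip R) (reverse l)
linked-reverse [] _ = []
linked-reverse (x ∷ l) linked = linked-reverseAcc x l [] linked [-]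

bounded⇒linked : ∀ {lb l} → All (lb ≤_) l → Linked _≤_ l → Linked _≤_ (lb ∷ l)
bounded⇒linked [] _ = [-]
bounded⇒linked (lb≤x ∷ _) linked = lb≤x ∷ linked

linked⇒bounded : ∀ {lb l} → Linked _≤_ (lb ∷ l) → All (lb ≤_) l
linked⇒bounded [-] = []
linked⇒bounded (lb≤x ∷ linked) = Linked⇒All ≤-trans lb≤x linked

Partition-≡ : ∀ {n} {p q : Partition n} → proj₁ p ≡ proj₁ q → p ≡ q
Partition-≡ {p = l , positive , decreasing , sum≡} {.l , positive' , decreasing' , sum≡'} refl =
  cong (l ,_) (cong₂ _,_ (All.irrelevant ≤-irrelevant positive positive')
    (cong₂ _,_ (Linked.irrelevant ≤-irrelevant decreasing decreasing') (≡-irrelevant sum≡ sum≡')))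

partition↔asc : ∀ n → Partition n ↔ Asc 1 n
partition↔asc n = mk↔ₛ′ to from to∘from from∘to
  where
  to : Partition n → Asc 1 n
  to (l , positive , decreasing , sum≡) =
    reverse l ,
    bounded⇒linked (All-resp-↭ (↭-sym (↭-reverse l)) positive) (linked-reverse l decreasing) ,
    trans (sum-↭ (↭-reverse l)) sum≡
  from : Asc 1 n → Partition n
  from (l , asc , sum≡) =
    reverse l ,
    All-resp-↭ (↭-sym (↭-reverse l)) (linked⇒bounded asc) ,
    linked-reverse l (Linked.tail asc) ,
    trans (sum-↭ (↭-reverse l)) sum≡
  to∘from : ∀ p → to (from p) ≡ p
  to∘from (l , _) = Asc-≡ (reverse-involutive l)
  from∘to : ∀ p → from (to p) ≡ p
  from∘to (l , _) = Partition-≡ (reverse-involutive l)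

-- The initial pass plus a sweep of cost 2h.
total-reads : ∀ h → h + h + 2 ≡ 2 * suc h
total-reads = solve-∀

-- The first outer pass reads a(2) - 1 = n - 1 and a(1) + 1 = 1, and the inner loop
-- writes 1, …, 1 at positions 1..n; sweeping from there costs 2h reads, where
-- h + 1 = p(n) = m.
theorem3p7 : (n : ℕ) → 0 < n → (m : ℕ) → Fin m ↔ Partition n →
    ∃ λ fuel → runRuleAsc fuel n ≡ just (2 * m)
theorem3p7 zero () m partitions
theorem3p7 (suc n) _ m partitions
  with h , count , fuelS , sweep ← enumerate (suc n) (m<m+n (suc n) ≤-refl) ≤-refl (s≤s z≤n)
  with fuelF , fill-ones ← fill 1 n ≤-refl
  with a₁ , k₁ , _ , first , run₁ ← fill-ones 1 (initArray (suc n)) 2 (fuelS + 1)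
  with a₂ , _ , _ , run₂ ← sweep 0 a₁ k₁ 2 1 first
  = suc (fuelF + (fuelS + 1)) , (begin
    runRuleAsc (suc (fuelF + (fuelS + 1))) (suc n)
      ≡⟨ outer-pass (fuelF + (fuelS + 1)) 0 (initArray (suc n)) 0 ⟩
    innerLoop (fuelF + (fuelS + 1)) 1 1 n (initArray (suc n)) 2
      ≡⟨ run₁ ⟩
    outerLoop (fuelS + 1) k₁ a₁ 2
      ≡⟨ run₂ ⟩
    just (h + h + 2)
      ≡⟨ cong just (total-reads h) ⟩
    just (2 * suc h)
      ≡⟨ cong (λ p → just (2 * p)) m≡p ⟩
    just (2 * m) ∎)
  where
  m≡p : suc h ≡ m
  m≡p = ↔⇒≡ (↔-trans count (↔-trans (↔-sym (partition↔asc (suc n))) (↔-sym partitions)))
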